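{- Let $k,d$ be positive integers with $d\equiv 0\pmod k$. There exists $n_0=n_0(d,k)$ such that $p(n,k,d)=\binom{n}{\le d/k}$ for every $n\ge n_0$. Moreover, the only $k$-wise $(n-d)$-union family $\mathcal{A}\subset 2^{[n]}$ of size $\binom{n}{\le d/k}$ is $\binom{[n]}{\le d/k}$.
   Context: $[n]=\{1,\dots,n\}$. A family $\mathcal{F}\subset 2^{[n]}$ is $k$-wise $(n-d)$-union if $|S_1\cup\cdots\cup S_k|\le d$ for all $S_1,\dots,S_k\in\mathcal{F}$; $p(n,k,d)$ is the maximum size of such a family. $\binom{[n]}{\le t}=\{S\subset[n]: |S|\le t\}$ and $\binom{n}{\le t}$ is its size. -}

module Defs where

open import Data.Nat using (ℕ; zero; suc; _+_; _≤_)
open import Data.Nat.Combinatorics using (_C_)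
open import Data.Fin using (Fin)
open import Data.Fin.Subset using (Subset; ⋃; ∣_∣)
open import Data.List using (List; length; tabulate)
open import Data.List.Membership.Propositional using (_∈_)
open import Data.List.Relation.Unary.Unique.Propositional using (Unique)
open import Data.Product using (Σ; _×_)
open import Function.Bundles using (_⇔_)
open import Relation.Binary.PropositionalEquality using (_≡_)

-- A family 𝓕 ⊂ 2^[n] is represented by a duplicate-free list of subsets
-- of Fin n (Subset n = Vec Side n); its size is the list length.
record Family (n : ℕ) : Set where
  constructor family
  field
    members  : List (Subset n)
    distinct : Unique members
open Family public

size : ∀ {n} → Family n → ℕ
size 𝓕 = length (members 𝓕)

-- k-wise (n-d)-union: |S₁ ∪ ⋯ ∪ S_k| ≤ d for all S₁,…,S_k ∈ 𝓕
-- (the S_i need not be distinct).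
KWiseUnion : (n k d : ℕ) → Family n → Set
KWiseUnion n k d 𝓕 =
  (S : Fin k → Subset n) → (∀ i → S i ∈ members 𝓕) → ∣ ⋃ (tabulate S) ∣ ≤ d

IsP : (n k d m : ℕ) → Set
IsP n k d m =
  ((𝓕 : Family n) → KWiseUnion n k d 𝓕 → size 𝓕 ≤ m)
  × Σ (Family n) (λ 𝓕 → KWiseUnion n k d 𝓕 × size 𝓕 ≡ m)

binomLe : ℕ → ℕ → ℕ
binomLe n zero    = n C 0
binomLe n (suc t) = binomLe n t + n C suc t

IsBall : (n t : ℕ) → Family n → Set
IsBall n t 𝓕 = (S : Subset n) → (S ∈ members 𝓕) ⇔ (∣ S ∣ ≤ t)

module Submission where

-- Proof.  Write d = t·k with t = d/k ≥ 1 and k ≥ 1, and put r = t - 1.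
--
-- * The ball binom([n], ≤ t) is k-wise (n-d)-union, since a union of k sets of size
--   ≤ t has at most k·t = d elements; it has binomLe n t members.
-- * A family all of whose members have size ≤ t is contained in the ball, so it is
--   no larger, and if it is as large then it is the ball (pigeonhole).
-- * A k-wise (n-d)-union family 𝓐 with a member A of size > t is small.  Starting from
--   U = A, greedily absorb members of 𝓐 that add at least t new points to U; the
--   union bound d forbids k - 1 such steps, and once no member can be absorbed,
--   every member v satisfies |U ∪ v| ≤ |U| + r with |U| ≤ d.  There are at most
--   2^d (n+1)^r such v, and for n ≥ n₀ this is less than C(n,t) ≤ binomLe n t.

open import Level using (0ℓ)
open import Data.Nat
  using (ℕ; zero; suc; _+_; _*_; _∸_; _^_; _≤_; _<_; z≤n; s≤s; s≤s⁻¹; _!; _/_; NonZero; >-nonZero)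
open import Data.Nat.Properties
open import Data.Nat.Combinatorics using (_C_; nCk+nC[k+1]≡[n+1]C[k+1]; nC1≡n)
open import Data.Nat.Divisibility using (_∣_; divides)
open import Data.Nat.DivMod using (m*n/n≡m)
open import Data.Nat.Tactic.RingSolver using (solve-∀)
open import Data.Vec using ([]; _∷_)
open import Data.Vec.Properties using (∷-injectiveʳ; ≡-dec)
import Data.Vec.Functional as Vector
open import Data.Bool using (true; false) renaming (_≟_ to _≟ᵇ_)
open import Data.Fin using (Fin; zero; suc)
open import Data.Fin.Subset using (Subset; ∣_∣; _∪_; ⋃; inside; outside)
open import Data.Fin.Subset.Properties using (∣p∣≤∣p∪q∣; ∣⊥∣≡0; ∪-assoc)
open import Data.List using (List; []; _∷_; _++_; map; filter; length; tabulate)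
open import Data.List.Properties using (filter-notAll; filter-++; length-++; filter-none)
open import Data.List.Relation.Unary.Any as Any using (here; there)
open import Data.List.Relation.Unary.All as All using (All; []; all?)
open import Data.List.Relation.Unary.All.Properties using (All¬⇒¬Any; ¬All⇒Any¬)
open import Data.List.Membership.Propositional using (_∈_; _∉_; find)
open import Data.List.Membership.Propositional.Properties
  using (∈-filter⁺; ∈-filter⁻; ∈-map⁺; ∈-map⁻; ∈-++⁺ˡ; ∈-++⁺ʳ)
open import Data.List.Membership.DecPropositional using () renaming (_∈?_ to member?)
open import Data.List.Relation.Unary.Unique.Propositional using (Unique)
import Data.List.Relation.Unary.Unique.Propositional.Properties as Unique
open import Data.List.Relation.Unary.AllPairs using ([]; _∷_)
open import Data.Product using (Σ; ∃; _×_; _,_; proj₂)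
open import Data.Sum using (_⊎_; inj₁; inj₂)
open import Data.Empty using (⊥-elim)
open import Function using (_∘_)
open import Function.Bundles using (mk⇔)
open import Relation.Nullary using (¬_; yes; no; ¬?; does)
open import Relation.Unary using (Pred; Decidable)
open import Relation.Binary.Definitions using (DecidableEquality)
open import Relation.Binary.PropositionalEquality
open import Defs

_≟ˢ_ : ∀ {n} → DecidableEquality (Subset n)
_≟ˢ_ = ≡-dec _≟ᵇ_

module _ {A : Set} (_≟_ : DecidableEquality A) where

  length-≤ : (L M : List A) → Unique L → (∀ {x} → x ∈ L → x ∈ M) → length L ≤ length M
  length-< : (L M : List A) → Unique L → (∀ {x} → x ∈ L → x ∈ M) →
             ∀ {z} → z ∈ M → z ∉ L → length L < length M

  length-≤ []      M _          _   = z≤n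
  length-≤ (x ∷ L) M (x∉L ∷ uL) L⊆M =
    length-< L M uL (L⊆M ∘ there) (L⊆M (here refl)) (All¬⇒¬Any x∉L)

  length-< L M uL L⊆M {z} z∈M z∉L =
    ≤-<-trans (length-≤ L (filter z≢? M) uL L⊆M-z)
              (filter-notAll z≢? M (Any.map (λ { refl z≢z → z≢z refl }) z∈M))
    where
    z≢? = λ y → ¬? (z ≟ y)
    L⊆M-z : ∀ {y} → y ∈ L → y ∈ filter z≢? M
    L⊆M-z y∈L = ∈-filter⁺ z≢? (L⊆M y∈L) (λ { refl → z∉L y∈L })

allSubsets : (n : ℕ) → List (Subset n)
allSubsets zero    = [] ∷ []
allSubsets (suc n) = map (outside ∷_) (allSubsets n) ++ map (inside ∷_) (allSubsets n)

∈-allSubsets : ∀ {n} (p : Subset n) → p ∈ allSubsets n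
∈-allSubsets []            = here refl
∈-allSubsets (outside ∷ p) = ∈-++⁺ˡ (∈-map⁺ _ (∈-allSubsets p))
∈-allSubsets {suc n} (inside ∷ p) =
  ∈-++⁺ʳ (map (outside ∷_) (allSubsets n)) (∈-map⁺ _ (∈-allSubsets p))

allSubsets-unique : ∀ n → Unique (allSubsets n)
allSubsets-unique zero    = [] ∷ []
allSubsets-unique (suc n) =
  Unique.++⁺ (Unique.map⁺ ∷-injectiveʳ (allSubsets-unique n))
             (Unique.map⁺ ∷-injectiveʳ (allSubsets-unique n)) disjoint
  where
  disjoint : ∀ {p} → ¬ (p ∈ map (outside ∷_) (allSubsets n) × p ∈ map (inside ∷_) (allSubsets n))
  disjoint (p∈out , p∈in) with ∈-map⁻ _ p∈out | ∈-map⁻ _ p∈in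
  ... | _ , _ , refl | _ , _ , ()

count : ∀ n {P : Pred (Subset n) 0ℓ} → Decidable P → ℕ
count n P? = length (filter P? (allSubsets n))

count-bound : ∀ {n} {P : Pred (Subset n) 0ℓ} (P? : Decidable P) (L : List (Subset n)) →
              Unique L → (∀ {p} → p ∈ L → P p) → length L ≤ count n P?
count-bound P? L uL L⊆P = length-≤ _≟ˢ_ L _ uL (λ p∈L → ∈-filter⁺ P? (∈-allSubsets _) (L⊆P p∈L))

count-mono : ∀ {n} {P Q : Pred (Subset n) 0ℓ} (P? : Decidable P) (Q? : Decidable Q) →
             (∀ {p} → P p → Q p) → count n P? ≤ count n Q?
count-mono {n} P? Q? P⇒Q =
  count-bound Q? (filter P? (allSubsets n)) (Unique.filter⁺ P? (allSubsets-unique n))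
              (P⇒Q ∘ proj₂ ∘ ∈-filter⁻ P? {xs = allSubsets n})

count-none : ∀ n {P : Pred (Subset n) 0ℓ} (P? : Decidable P) → (∀ p → ¬ P p) → count n P? ≡ 0
count-none n P? none = cong length (filter-none P? {xs = allSubsets n} (All.tabulate λ {p} _ → none p))

count-split : ∀ n {P : Pred (Subset (suc n)) 0ℓ} (P? : Decidable P) →
              count (suc n) P? ≡ count n (P? ∘ (outside ∷_)) + count n (P? ∘ (inside ∷_))
count-split n P? = begin
  length (filter P? (outs ++ ins))
    ≡⟨ cong length (filter-++ P? outs ins) ⟩
  length (filter P? outs ++ filter P? ins)
    ≡⟨ length-++ (filter P? outs) ⟩
  length (filter P? outs) + length (filter P? ins)
    ≡⟨ cong₂ _+_ (length-filter-map (outside ∷_) (allSubsets n))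
                 (length-filter-map (inside ∷_) (allSubsets n)) ⟩
  count n (P? ∘ (outside ∷_)) + count n (P? ∘ (inside ∷_)) ∎
  where
  open ≡-Reasoning
  outs = map (outside ∷_) (allSubsets n)
  ins  = map (inside ∷_) (allSubsets n)
  length-filter-map : (f : Subset n → Subset (suc n)) (ps : List (Subset n)) →
                      length (filter P? (map f ps)) ≡ length (filter (P? ∘ f) ps)
  length-filter-map f []       = refl
  length-filter-map f (p ∷ ps) with does (P? (f p))
  ... | true  = cong suc (length-filter-map f ps)
  ... | false = length-filter-map f ps

binomLe-zero : ∀ t → binomLe 0 t ≡ 1
binomLe-zero zero    = refl
binomLe-zero (suc t) = trans (+-identityʳ _) (binomLe-zero t)

binomLe-pascal : ∀ n t → binomLe (suc n) (suc t) ≡ binomLe n (suc t) + binomLe n t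
binomLe-pascal n zero = begin
  1 + suc n C 1         ≡⟨ cong (1 +_) (sym (nCk+nC[k+1]≡[n+1]C[k+1] n 0)) ⟩
  1 + (1 + n C 1)       ≡⟨ +-comm 1 (1 + n C 1) ⟩
  (1 + n C 1) + 1       ∎
  where open ≡-Reasoning
binomLe-pascal n (suc t) = begin
  binomLe (suc n) (suc t) + suc n C suc (suc t)
    ≡⟨ cong₂ _+_ (binomLe-pascal n t) (sym (nCk+nC[k+1]≡[n+1]C[k+1] n (suc t))) ⟩
  (binomLe n (suc t) + binomLe n t) + (n C suc t + n C suc (suc t))
    ≡⟨ regroup (binomLe n (suc t)) (binomLe n t) (n C suc t) (n C suc (suc t)) ⟩
  (binomLe n (suc t) + n C suc (suc t)) + (binomLe n t + n C suc t) ∎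
  where
  open ≡-Reasoning
  regroup : ∀ a b c e → (a + b) + (c + e) ≡ (a + e) + (b + c)
  regroup = solve-∀

small? : ∀ {n} (t : ℕ) → Decidable (λ (p : Subset n) → ∣ p ∣ ≤ t)
small? t p = ∣ p ∣ ≤? t

count-small : ∀ n t → count n (small? t) ≡ binomLe n t
count-small zero    t       = sym (binomLe-zero t)
count-small (suc n) zero    = begin
  count (suc n) (small? 0)                        ≡⟨ count-split n (small? 0) ⟩
  count n (small? 0) + count n (small? 0 ∘ (inside ∷_))
    ≡⟨ cong₂ _+_ (count-small n 0) (count-none n _ (λ p ())) ⟩
  binomLe n 0 + 0                                 ≡⟨ +-identityʳ 1 ⟩
  binomLe (suc n) 0                               ∎
  where open ≡-Reasoning
count-small (suc n) (suc t) = begin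
  count (suc n) (small? (suc t))                  ≡⟨ count-split n (small? (suc t)) ⟩
  count n (small? (suc t)) + count n (small? (suc t) ∘ (inside ∷_))
    ≡⟨ cong (count n (small? (suc t)) +_)
            (≤-antisym (count-mono {n} shifted (small? t) s≤s⁻¹) (count-mono {n} (small? t) shifted s≤s)) ⟩
  count n (small? (suc t)) + count n (small? t)
    ≡⟨ cong₂ _+_ (count-small n (suc t)) (count-small n t) ⟩
  binomLe n (suc t) + binomLe n t                 ≡⟨ binomLe-pascal n t ⟨
  binomLe (suc n) (suc t)                         ∎
  where
  open ≡-Reasoning
  shifted = small? (suc t) ∘ (inside ∷_)

ball : (n t : ℕ) → Family n
ball n t = family (filter (small? t) (allSubsets n)) (Unique.filter⁺ (small? t) (allSubsets-unique n))

∈-ball : ∀ {n t} (p : Subset n) → ∣ p ∣ ≤ t → p ∈ members (ball n t)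
∈-ball p p-small = ∈-filter⁺ (small? _) (∈-allSubsets p) p-small

∣p∪q∣≤∣p∣+∣q∣ : ∀ {n} (p q : Subset n) → ∣ p ∪ q ∣ ≤ ∣ p ∣ + ∣ q ∣
∣p∪q∣≤∣p∣+∣q∣ []            []            = z≤n
∣p∪q∣≤∣p∣+∣q∣ (inside ∷ p)  (inside ∷ q)  =
  s≤s (≤-trans (∣p∪q∣≤∣p∣+∣q∣ p q) (≤-trans (n≤1+n _) (≤-reflexive (sym (+-suc ∣ p ∣ ∣ q ∣)))))
∣p∪q∣≤∣p∣+∣q∣ (inside ∷ p)  (outside ∷ q) = s≤s (∣p∪q∣≤∣p∣+∣q∣ p q)
∣p∪q∣≤∣p∣+∣q∣ (outside ∷ p) (inside ∷ q)  =
  ≤-trans (s≤s (∣p∪q∣≤∣p∣+∣q∣ p q)) (≤-reflexive (sym (+-suc ∣ p ∣ ∣ q ∣)))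
∣p∪q∣≤∣p∣+∣q∣ (outside ∷ p) (outside ∷ q) = ∣p∪q∣≤∣p∣+∣q∣ p q

∣⋃∣≤k*t : ∀ {n} t k (S : Fin k → Subset n) → (∀ i → ∣ S i ∣ ≤ t) → ∣ ⋃ (tabulate S) ∣ ≤ k * t
∣⋃∣≤k*t {n} t zero    S S-small = ≤-reflexive (∣⊥∣≡0 n)
∣⋃∣≤k*t     t (suc k) S S-small =
  ≤-trans (∣p∪q∣≤∣p∣+∣q∣ (S zero) (⋃ (tabulate (S ∘ suc))))
          (+-mono-≤ (S-small zero) (∣⋃∣≤k*t t k (S ∘ suc) (S-small ∘ suc)))

ball-kwise : ∀ n k t → KWiseUnion n k (t * k) (ball n t)
ball-kwise n k t S S∈ball =
  ≤-trans (∣⋃∣≤k*t t k S (proj₂ ∘ ∈-filter⁻ (small? t) {xs = allSubsets n} ∘ S∈ball))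
          (≤-reflexive (*-comm k t))

inside-ball-size : ∀ {n} t (𝓕 : Family n) → All (λ p → ∣ p ∣ ≤ t) (members 𝓕) → size 𝓕 ≤ binomLe n t
inside-ball-size {n} t 𝓕 𝓕-small =
  ≤-trans (count-bound (small? t) (members 𝓕) (distinct 𝓕) (All.lookup 𝓕-small))
          (≤-reflexive (count-small n t))

inside-ball-full : ∀ {n} t (𝓕 : Family n) → All (λ p → ∣ p ∣ ≤ t) (members 𝓕) →
                   size 𝓕 ≡ binomLe n t → IsBall n t 𝓕
inside-ball-full {n} t 𝓕 𝓕-small full p = mk⇔ (All.lookup 𝓕-small) p-in-𝓕
  where
  p-in-𝓕 : ∣ p ∣ ≤ t → p ∈ members 𝓕
  p-in-𝓕 p-small with member? _≟ˢ_ p (members 𝓕)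
  ... | yes p∈𝓕 = p∈𝓕
  ... | no  p∉𝓕 = ⊥-elim (<-irrefl full (<-≤-trans
          (length-< _≟ˢ_ (members 𝓕) (members (ball n t)) (distinct 𝓕)
                    (λ {q} q∈𝓕 → ∈-ball q (All.lookup 𝓕-small q∈𝓕)) (∈-ball p p-small) p∉𝓕)
          (≤-reflexive (count-small n t))))

near? : ∀ {n} (U : Subset n) (r : ℕ) → Decidable (λ v → ∣ U ∪ v ∣ ≤ ∣ U ∣ + r)
near? U r v = ∣ U ∪ v ∣ ≤? ∣ U ∣ + r

^-step : ∀ a r → a ^ suc r + a ^ r ≤ suc a ^ suc r
^-step a r = begin
  a * a ^ r + a ^ r     ≡⟨ +-comm (a * a ^ r) (a ^ r) ⟩
  suc a * a ^ r         ≤⟨ *-monoʳ-≤ (suc a) (^-monoˡ-≤ r (n≤1+n a)) ⟩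
  suc a * suc a ^ r     ∎
  where open ≤-Reasoning

-- The r-neighbourhood of U has at most 2^|U| (n+1)^r elements: v ∩ U is arbitrary,
-- and v ∖ U is one of at most (n+1)^r small sets.
count-near : ∀ n (U : Subset n) r → count n (near? U r) ≤ 2 ^ ∣ U ∣ * suc n ^ r
count-near zero    []           r       = ≤-reflexive (sym (trans (+-identityʳ (1 ^ r)) (^-zeroˡ r)))
count-near (suc n) (inside ∷ U) r       = begin
  count (suc n) (near? (inside ∷ U) r)          ≡⟨ count-split n (near? (inside ∷ U) r) ⟩
  count n _ + count n _
    ≤⟨ +-mono-≤ (count-mono _ (near? U r) s≤s⁻¹) (count-mono _ (near? U r) s≤s⁻¹) ⟩
  count n (near? U r) + count n (near? U r)     ≤⟨ +-mono-≤ (count-near n U r) (count-near n U r) ⟩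
  2 ^ ∣ U ∣ * suc n ^ r + 2 ^ ∣ U ∣ * suc n ^ r ≡⟨ twice (2 ^ ∣ U ∣) (suc n ^ r) ⟩
  2 ^ suc ∣ U ∣ * suc n ^ r                     ≤⟨ *-monoʳ-≤ (2 ^ suc ∣ U ∣) (^-monoˡ-≤ r (n≤1+n (suc n))) ⟩
  2 ^ suc ∣ U ∣ * suc (suc n) ^ r               ∎
  where
  open ≤-Reasoning
  twice : ∀ a b → a * b + a * b ≡ (2 * a) * b
  twice = solve-∀
count-near (suc n) (outside ∷ U) zero   = begin
  count (suc n) (near? (outside ∷ U) 0)         ≡⟨ count-split n (near? (outside ∷ U) 0) ⟩
  count n _ + count n _
    ≡⟨ cong (count n (near? U 0) +_) (count-none n _ far) ⟩
  count n (near? U 0) + 0                       ≤⟨ +-monoˡ-≤ 0 (count-near n U 0) ⟩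
  2 ^ ∣ U ∣ * 1 + 0                             ≡⟨ +-identityʳ _ ⟩
  2 ^ ∣ U ∣ * 1                                 ∎
  where
  open ≤-Reasoning
  far : ∀ v → ¬ (suc ∣ U ∪ v ∣ ≤ ∣ U ∣ + 0)
  far v U∪v<U = <⇒≱ U∪v<U (≤-trans (≤-reflexive (+-identityʳ ∣ U ∣)) (∣p∣≤∣p∪q∣ U v))
count-near (suc n) (outside ∷ U) (suc r) = begin
  count (suc n) (near? (outside ∷ U) (suc r))   ≡⟨ count-split n (near? (outside ∷ U) (suc r)) ⟩
  count n _ + count n _
    ≤⟨ +-monoʳ-≤ (count n (near? U (suc r)))
                 (count-mono _ (near? U r) (λ le → s≤s⁻¹ (≤-trans le (≤-reflexive (+-suc ∣ U ∣ r))))) ⟩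
  count n (near? U (suc r)) + count n (near? U r)
    ≤⟨ +-mono-≤ (count-near n U (suc r)) (count-near n U r) ⟩
  2 ^ ∣ U ∣ * suc n ^ suc r + 2 ^ ∣ U ∣ * suc n ^ r
    ≡⟨ *-distribˡ-+ (2 ^ ∣ U ∣) (suc n ^ suc r) (suc n ^ r) ⟨
  2 ^ ∣ U ∣ * (suc n ^ suc r + suc n ^ r)       ≤⟨ *-monoʳ-≤ (2 ^ ∣ U ∣) (^-step (suc n) r) ⟩
  2 ^ ∣ U ∣ * suc (suc n) ^ suc r               ∎
  where open ≤-Reasoning

module Absorption {n : ℕ} (L : List (Subset n)) (L-unique : Unique L) (B r : ℕ) where

  record Trapped (j : ℕ) (U : Subset n) : Set where
    field
      size-bounded   : ∣ U ∣ ≤ B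
      unions-bounded : (S : Fin j → Subset n) → (∀ i → S i ∈ L) → ∣ U ∪ ⋃ (tabulate S) ∣ ≤ B
      overflow       : B < ∣ U ∣ + j * suc r

  absorb : ∀ {j U A} → Trapped (suc j) U → A ∈ L → ∣ U ∣ + suc r ≤ ∣ U ∪ A ∣ → Trapped j (U ∪ A)
  absorb {j} {U} {A} trapped A∈L grows = record
    { size-bounded   = ≤-trans (∣p∣≤∣p∪q∣ (U ∪ A) _) (unions-with-A (λ _ → A) (λ _ → A∈L))
    ; unions-bounded = unions-with-A
    ; overflow       = begin-strict
        B                                <⟨ overflow ⟩
        ∣ U ∣ + (suc r + j * suc r)      ≡⟨ +-assoc ∣ U ∣ (suc r) (j * suc r) ⟨
        ∣ U ∣ + suc r + j * suc r        ≤⟨ +-monoˡ-≤ (j * suc r) grows ⟩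
        ∣ U ∪ A ∣ + j * suc r            ∎
    }
    where
    open Trapped trapped
    open ≤-Reasoning
    unions-with-A : (S : Fin j → Subset n) → (∀ i → S i ∈ L) → ∣ (U ∪ A) ∪ ⋃ (tabulate S) ∣ ≤ B
    unions-with-A S S∈L = begin
      ∣ (U ∪ A) ∪ ⋃ (tabulate S) ∣           ≡⟨ cong ∣_∣ (∪-assoc U A _) ⟩
      ∣ U ∪ ⋃ (tabulate (A Vector.∷ S)) ∣    ≤⟨ unions-bounded (A Vector.∷ S) (λ { zero → A∈L ; (suc i) → S∈L i }) ⟩
      B                                      ∎

  -- If U is trapped then L is small: absorb greedily until no member adds t new
  -- points; by then every member lies in the r-neighbourhood of U.
  trapped-length : ∀ j U → Trapped j U → length L ≤ 2 ^ B * suc n ^ r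
  trapped-length zero U trapped =
    ⊥-elim (<⇒≱ overflow (≤-trans (≤-reflexive (+-identityʳ ∣ U ∣)) size-bounded))
    where open Trapped trapped
  trapped-length (suc j) U trapped with all? (near? U r) L
  ... | yes all-near = begin
      length L                    ≤⟨ count-bound (near? U r) L L-unique (All.lookup all-near) ⟩
      count n (near? U r)         ≤⟨ count-near n U r ⟩
      2 ^ ∣ U ∣ * suc n ^ r       ≤⟨ *-monoˡ-≤ (suc n ^ r) (^-monoʳ-≤ 2 (Trapped.size-bounded trapped)) ⟩
      2 ^ B * suc n ^ r           ∎
    where open ≤-Reasoning
  ... | no not-all-near with find (¬All⇒Any¬ (near? U r) L not-all-near)
  ... | A , A∈L , A-far =
      trapped-length j (U ∪ A) (absorb trapped A∈L (≤-trans (≤-reflexive (+-suc ∣ U ∣ r)) (≰⇒> A-far)))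

absorption : ∀ n k → suc k * (suc n C suc k) ≡ suc n * (n C k)
absorption n       zero    = trans (*-identityˡ _) (trans (nC1≡n (suc n)) (sym (*-identityʳ _)))
absorption zero    (suc k) = *-zeroʳ (suc (suc k))
absorption (suc n) (suc k) = begin
  (2 + k) * (suc (suc n) C suc (suc k))
    ≡⟨ cong ((2 + k) *_) (sym (nCk+nC[k+1]≡[n+1]C[k+1] (suc n) (suc k))) ⟩
  (2 + k) * (a + c′)                    ≡⟨ expand k a c′ ⟩
  (1 + k) * a + a + (2 + k) * c′        ≡⟨ cong₂ (λ x y → x + a + y) (absorption n k) (absorption n (suc k)) ⟩
  (1 + n) * b + a + (1 + n) * c         ≡⟨ collect n a b c ⟩
  (1 + n) * (b + c) + a                 ≡⟨ cong (λ x → (1 + n) * x + a) (nCk+nC[k+1]≡[n+1]C[k+1] n k) ⟩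
  (1 + n) * a + a                       ≡⟨ +-comm ((1 + n) * a) a ⟩
  (2 + n) * a                           ∎
  where
  open ≡-Reasoning
  a  = suc n C suc k
  b  = n C k
  c  = n C suc k
  c′ = suc n C suc (suc k)
  expand : ∀ k a x → (2 + k) * (a + x) ≡ (1 + k) * a + a + (2 + k) * x
  expand = solve-∀
  collect : ∀ n a b c → (1 + n) * b + a + (1 + n) * c ≡ (1 + n) * (b + c) + a
  collect = solve-∀

-- C(m+t,t) = (m+1)⋯(m+t)/t! ≥ (m+1)^t / t!.
^≤!*C : ∀ m t → suc m ^ t ≤ t ! * ((m + t) C t)
^≤!*C m zero    = ≤-refl
^≤!*C m (suc t) rewrite +-suc m t = begin
  suc m * suc m ^ t                     ≤⟨ *-mono-≤ (s≤s (m≤m+n m t)) (^≤!*C m t) ⟩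
  suc (m + t) * (t ! * ((m + t) C t))   ≡⟨ x*[y*z]≡y*[x*z] (suc (m + t)) (t !) ((m + t) C t) ⟩
  t ! * (suc (m + t) * ((m + t) C t))   ≡⟨ cong (t ! *_) (absorption (m + t) t) ⟨
  t ! * (suc t * (suc (m + t) C suc t)) ≡⟨ x*[y*z]≡[y*x]*z (t !) (suc t) (suc (m + t) C suc t) ⟩
  (suc t * t !) * (suc (m + t) C suc t) ∎
  where
  open ≤-Reasoning
  x*[y*z]≡y*[x*z] : ∀ x y z → x * (y * z) ≡ y * (x * z)
  x*[y*z]≡y*[x*z] = solve-∀
  x*[y*z]≡[y*x]*z : ∀ x y z → x * (y * z) ≡ (y * x) * z
  x*[y*z]≡[y*x]*z = solve-∀

^-distribʳ-* : ∀ a b r → (a * b) ^ r ≡ a ^ r * b ^ r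
^-distribʳ-* a b zero    = refl
^-distribʳ-* a b (suc r) = trans (cong ((a * b) *_) (^-distribʳ-* a b r)) (interchange a b (a ^ r) (b ^ r))
  where
  interchange : ∀ a b x y → (a * b) * (x * y) ≡ (a * x) * (b * y)
  interchange = solve-∀

C≤binomLe : ∀ n t → n C t ≤ binomLe n t
C≤binomLe n zero    = ≤-refl
C≤binomLe n (suc t) = m≤n+m _ _

-- Writing n = m + t with m ≥ t!·K·(t+1)^r, one has n+1 ≤ (m+1)(t+1) and
-- t!·K·(n+1)^r ≤ t!·K·(t+1)^r·(m+1)^r < (m+1)^t ≤ t!·C(n,t).
polynomial<binomLe : ∀ K r n → (suc r) ! * K * (suc (suc r)) ^ r + suc r ≤ n → K * suc n ^ r < binomLe n (suc r)
polynomial<binomLe K r n n-large = <-≤-trans (*-cancelˡ-< (t !) _ _ scaled) (C≤binomLe n t)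
  where
  open ≤-Reasoning
  t  = suc r
  m  = n ∸ t
  K′ = t ! * K * suc t ^ r
  m+t≡n : m + t ≡ n
  m+t≡n = m∸n+n≡m (≤-trans (m≤n+m t K′) n-large)
  K′≤m : K′ ≤ m
  K′≤m = ≤-trans (≤-reflexive (sym (m+n∸n≡m K′ t))) (∸-monoˡ-≤ t n-large)
  n+1≤[m+1][t+1] : suc n ≤ suc m * suc t
  n+1≤[m+1][t+1] = begin
    suc n               ≡⟨ cong suc m+t≡n ⟨
    suc (m + t)         ≤⟨ s≤s (+-monoʳ-≤ m (m≤m*n t (suc m))) ⟩
    suc (m + t * suc m) ≡⟨ expand m t ⟩
    suc m * suc t       ∎
    where
    expand : ∀ m t → suc (m + t * suc m) ≡ suc m * suc t
    expand = solve-∀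
  scaled : t ! * (K * suc n ^ r) < t ! * (n C t)
  scaled = begin-strict
    t ! * (K * suc n ^ r)                 ≤⟨ *-monoʳ-≤ (t !) (*-monoʳ-≤ K (^-monoˡ-≤ r n+1≤[m+1][t+1])) ⟩
    t ! * (K * (suc m * suc t) ^ r)       ≡⟨ cong (λ x → t ! * (K * x)) (^-distribʳ-* (suc m) (suc t) r) ⟩
    t ! * (K * (suc m ^ r * suc t ^ r))   ≡⟨ regroup (t !) K (suc m ^ r) (suc t ^ r) ⟩
    K′ * suc m ^ r                        <⟨ *-monoˡ-< (suc m ^ r) {{>-nonZero (m^n>0 (suc m) r)}} (s≤s K′≤m) ⟩
    suc m ^ t                             ≤⟨ ^≤!*C m t ⟩
    t ! * ((m + t) C t)                   ≡⟨ cong (λ x → t ! * (x C t)) m+t≡n ⟩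
    t ! * (n C t)                         ∎
    where
    regroup : ∀ f K x y → f * (K * (x * y)) ≡ f * K * y * x
    regroup = solve-∀

inside-or-large : ∀ {n} t (𝓕 : Family n) →
                  All (λ p → ∣ p ∣ ≤ t) (members 𝓕) ⊎ ∃ (λ A → A ∈ members 𝓕 × t < ∣ A ∣)
inside-or-large t 𝓕 with all? (small? t) (members 𝓕)
... | yes all-small = inj₁ all-small
... | no  not-all-small with find (¬All⇒Any¬ (small? t) (members 𝓕) not-all-small)
...   | A , A∈𝓕 , A-large = inj₂ (A , A∈𝓕 , ≰⇒> A-large)

-- From now on t = r+1 and k = j+1, so d = t·k; the threshold n₀ is the one of the
-- growth estimate for K = 2^d.
threshold : ℕ → ℕ → ℕ
threshold r j = (suc r) ! * 2 ^ (suc r * suc j) * suc (suc r) ^ r + suc r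

-- A k-wise (n-d)-union family with a member A of size > t is smaller than the ball:
-- A is trapped with k-1 steps left and bound d.
large-member⇒small : ∀ r j n → threshold r j ≤ n →
  (𝓐 : Family n) → KWiseUnion n (suc j) (suc r * suc j) 𝓐 →
  ∀ {A} → A ∈ members 𝓐 → suc r < ∣ A ∣ → size 𝓐 < binomLe n (suc r)
large-member⇒small r j n n-large 𝓐 kwise {A} A∈𝓐 A-large = begin-strict
  size 𝓐                 ≤⟨ trapped-length j A A-trapped ⟩
  2 ^ d * suc n ^ r      <⟨ polynomial<binomLe (2 ^ d) r n n-large ⟩
  binomLe n (suc r)      ∎
  where
  open ≤-Reasoning
  d = suc r * suc j
  open Absorption (members 𝓐) (distinct 𝓐) d r
  A-trapped : Trapped j A
  A-trapped = record
    { size-bounded   = ≤-trans (∣p∣≤∣p∪q∣ A _) (kwise (λ _ → A) (λ _ → A∈𝓐))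
    ; unions-bounded = λ S S∈𝓐 → kwise (A Vector.∷ S) (λ { zero → A∈𝓐 ; (suc i) → S∈𝓐 i })
    ; overflow       = begin-strict
        suc r * suc j       ≡⟨ *-comm (suc r) (suc j) ⟩
        suc r + j * suc r   <⟨ +-monoˡ-< (j * suc r) A-large ⟩
        ∣ A ∣ + j * suc r   ∎
    }

ball-is-unique-maximum : ∀ r j n → threshold r j ≤ n →
  IsP n (suc j) (suc r * suc j) (binomLe n (suc r))
  × ((𝓐 : Family n) → KWiseUnion n (suc j) (suc r * suc j) 𝓐 → size 𝓐 ≡ binomLe n (suc r) →
     IsBall n (suc r) 𝓐)
ball-is-unique-maximum r j n n-large =
  (at-most-ball , ball n t , ball-kwise n (suc j) t , count-small n t) , only-ball
  where
  t = suc r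
  at-most-ball : (𝓕 : Family n) → KWiseUnion n (suc j) (t * suc j) 𝓕 → size 𝓕 ≤ binomLe n t
  at-most-ball 𝓕 kwise with inside-or-large t 𝓕
  ... | inj₁ 𝓕-small               = inside-ball-size t 𝓕 𝓕-small
  ... | inj₂ (A , A∈𝓕 , A-large)   = <⇒≤ (large-member⇒small r j n n-large 𝓕 kwise A∈𝓕 A-large)
  only-ball : (𝓐 : Family n) → KWiseUnion n (suc j) (t * suc j) 𝓐 → size 𝓐 ≡ binomLe n t → IsBall n t 𝓐
  only-ball 𝓐 kwise full with inside-or-large t 𝓐
  ... | inj₁ 𝓐-small               = inside-ball-full t 𝓐 𝓐-small full
  ... | inj₂ (A , A∈𝓐 , A-large)   =
    ⊥-elim (<-irrefl full (large-member⇒small r j n n-large 𝓐 kwise A∈𝓐 A-large))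

proposition9 : (k d : ℕ) → .{{_ : NonZero k}} → .{{_ : NonZero d}} → k ∣ d →
    Σ ℕ (λ n₀ → (n : ℕ) → n₀ ≤ n →
    IsP n k d (binomLe n (d / k))
    × ((𝓐 : Family n) → KWiseUnion n k d 𝓐 → size 𝓐 ≡ binomLe n (d / k) →
    IsBall n (d / k) 𝓐))
proposition9 (suc j) .(zero * suc j)    {{_}} {{()}} (divides zero refl)
proposition9 (suc j) .(suc r * suc j) (divides (suc r) refl)
  rewrite m*n/n≡m (suc r) (suc j) {{_}} = threshold r j , ball-is-unique-maximum r j
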